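{- If $G$ is a self-complementary graph (i.e. $G$ is isomorphic to its complement), then $\rho_T(G)=\rho_{\widehat{T}}(G)$.
   Context: Graphs are finite and simple. For vectors of length $k$, $u\odot v=\min_i(u_i+v_i)$ and $u\,\widehat{\odot}\,v=\max_i(u_i+v_i)$. $\rho_T(G)$ (resp. $\rho_{\widehat{T}}(G)$) is the minimum $k$ such that there is $f:V(G)\to(\mathbb{R}\cup\{\infty\})^k$ (resp. $(\mathbb{R}\cup\{ -\infty\})^k$) and a threshold $t>0$ with, for all distinct $x,y$, $xy\in E(G)$ iff $f(x)\odot f(y)\ge t$ (resp. $f(x)\,\widehat{\odot}\,f(y)\ge t$). -}

module Defs where

open import Level using (Level; 0ℓ) renaming (suc to lsuc)
open import Data.Nat using (ℕ) renaming (_≤_ to _≤ℕ_)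
open import Data.Fin using (Fin; _≟_)
open import Data.Bool using (Bool; true; false; not; if_then_else_)
open import Data.Maybe using (Maybe; just; nothing)
open import Data.Product using (Σ; ∃; _×_; _,_)
open import Data.Sum using (_⊎_)
open import Data.Unit using (⊤)
open import Data.Empty using (⊥)
open import Relation.Nullary using (¬_)
open import Relation.Nullary.Decidable using (⌊_⌋)
open import Relation.Binary.PropositionalEquality using (_≡_; _≢_)
open import Function.Bundles using (_⇔_; _↔_; Inverse)

-- The real numbers, axiomatised as a (Dedekind-)complete ordered field.
-- Any model of this record is (classically) isomorphic to ℝ.

record RealField : Set₁ where
  infixl 6 _+_
  infixl 7 _*_
  infix 4 _≤_
  field
    Carrier : Set
    0# 1#   : Carrier
    _+_ _*_ : Carrier → Carrier → Carrier
    -_      : Carrier → Carrier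
    _≤_     : Carrier → Carrier → Set
    +-assoc     : ∀ x y z → (x + y) + z ≡ x + (y + z)
    +-comm      : ∀ x y → x + y ≡ y + x
    +-identityʳ : ∀ x → x + 0# ≡ x
    +-inverseʳ  : ∀ x → x + (- x) ≡ 0#
    *-assoc     : ∀ x y z → (x * y) * z ≡ x * (y * z)
    *-comm      : ∀ x y → x * y ≡ y * x
    *-identityʳ : ∀ x → x * 1# ≡ x
    distribˡ    : ∀ x y z → x * (y + z) ≡ x * y + x * z
    0≢1         : 0# ≢ 1#
    *-inverse   : ∀ x → x ≢ 0# → Σ Carrier (λ y → x * y ≡ 1#)
    ≤-refl      : ∀ x → x ≤ x
    ≤-trans     : ∀ {x y z} → x ≤ y → y ≤ z → x ≤ z
    ≤-antisym   : ∀ {x y} → x ≤ y → y ≤ x → x ≡ y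
    ≤-total     : ∀ x y → x ≤ y ⊎ y ≤ x
    +-mono-≤    : ∀ {x y} z → x ≤ y → x + z ≤ y + z
    *-nonneg    : ∀ {x y} → 0# ≤ x → 0# ≤ y → 0# ≤ x * y
    complete    : (P : Carrier → Set) → Σ Carrier P →
                  Σ Carrier (λ b → ∀ x → P x → x ≤ b) →
                  Σ Carrier (λ s → (∀ x → P x → x ≤ s) ×
                                   (∀ b → (∀ x → P x → x ≤ b) → s ≤ b))

  _<_ : Carrier → Carrier → Set
  x < y = (x ≤ y) × (x ≢ y)

record Graph (n : ℕ) : Set where
  field
    adj    : Fin n → Fin n → Bool
    sym    : ∀ x y → adj x y ≡ adj y x
    irrefl : ∀ x → adj x x ≡ false
open Graph public

complement : ∀ {n} → Graph n → Graph n
complement {n} G = record { adj = a ; sym = s ; irrefl = i }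
  where
  a : Fin n → Fin n → Bool
  a x y = if ⌊ x ≟ y ⌋ then false else not (adj G x y)
  s : ∀ x y → a x y ≡ a y x
  s x y with x ≟ y | y ≟ x
  ... | Relation.Nullary.yes _ | Relation.Nullary.yes _ = Relation.Binary.PropositionalEquality.refl
  ... | Relation.Nullary.yes p | Relation.Nullary.no q = Data.Empty.⊥-elim (q (Relation.Binary.PropositionalEquality.sym p))
  ... | Relation.Nullary.no q | Relation.Nullary.yes p = Data.Empty.⊥-elim (q (Relation.Binary.PropositionalEquality.sym p))
  ... | Relation.Nullary.no _ | Relation.Nullary.no _ = Relation.Binary.PropositionalEquality.cong not (sym G x y)
  i : ∀ x → a x x ≡ false
  i x with x ≟ x
  ... | Relation.Nullary.yes _ = Relation.Binary.PropositionalEquality.refl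
  ... | Relation.Nullary.no q = Data.Empty.⊥-elim (q Relation.Binary.PropositionalEquality.refl)

_≅_ : ∀ {n} → Graph n → Graph n → Set
_≅_ {n} G H = Σ (Fin n ↔ Fin n) λ σ →
  ∀ x y → adj G x y ≡ adj H (Inverse.to σ x) (Inverse.to σ y)

SelfComplementary : ∀ {n} → Graph n → Set
SelfComplementary G = G ≅ complement G

module _ (R : RealField) where
  open RealField R

  -- ℝ ∪ {∞}: nothing stands for ∞.   ℝ ∪ {-∞}: nothing stands for -∞.
  -- "a + b ≥ t" for a, b ∈ ℝ ∪ {∞}
  sumGe∞ : Maybe Carrier → Maybe Carrier → Carrier → Set
  sumGe∞ nothing  _        t = ⊤
  sumGe∞ (just a) nothing  t = ⊤
  sumGe∞ (just a) (just b) t = t ≤ a + b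

  sumGe-∞ : Maybe Carrier → Maybe Carrier → Carrier → Set
  sumGe-∞ nothing  _        t = ⊥
  sumGe-∞ (just a) nothing  t = ⊥
  sumGe-∞ (just a) (just b) t = t ≤ a + b

  minPlusGe : ∀ {k} → (Fin k → Maybe Carrier) → (Fin k → Maybe Carrier) → Carrier → Set
  minPlusGe u v t = ∀ i → sumGe∞ (u i) (v i) t

  maxPlusGe : ∀ {k} → (Fin k → Maybe Carrier) → (Fin k → Maybe Carrier) → Carrier → Set
  maxPlusGe u v t = ∃ λ i → sumGe-∞ (u i) (v i) t

  TropRep : ∀ {n} → Graph n → ℕ → Set
  TropRep {n} G k = Σ (Fin n → Fin k → Maybe Carrier) λ f → Σ Carrier λ t →
    (0# < t) × (∀ x y → x ≢ y → (adj G x y ≡ true ⇔ minPlusGe (f x) (f y) t))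

  TropRepMax : ∀ {n} → Graph n → ℕ → Set
  TropRepMax {n} G k = Σ (Fin n → Fin k → Maybe Carrier) λ f → Σ Carrier λ t →
    (0# < t) × (∀ x y → x ≢ y → (adj G x y ≡ true ⇔ maxPlusGe (f x) (f y) t))

IsMinimum : (ℕ → Set) → ℕ → Set
IsMinimum P k = P k × (∀ j → P j → k ≤ℕ j)

IsRhoT : RealField → ∀ {n} → Graph n → ℕ → Set
IsRhoT R G = IsMinimum (TropRep R G)

IsRhoTMax : RealField → ∀ {n} → Graph n → ℕ → Set
IsRhoTMax R G = IsMinimum (TropRepMax R G)

-- Negating all coordinates about t exchanges ∞ with -∞ and reverses sums:
-- (t - a) + (t - b) ≥ 2t - m  iff  a + b ≤ m.  In a min-plus representation
-- with threshold t every non-edge has a finite coordinate sum below t, and by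
-- finiteness some m < t bounds all of these; then x ↦ t - f(x) with threshold
-- 2t - m is a max-plus representation of the complement.  Dually a max-plus
-- representation yields a min-plus one of the complement, in the same
-- dimension.  Composing with an isomorphism G ≅ Ḡ, G has a min-plus
-- representation of dimension k iff it has a max-plus one, so the minima agree.
module Submission where

open import Defs hiding (sym)
open import Level using (0ℓ)
open import Algebra.Bundles using (AbelianGroup)
open import Algebra.Consequences.Propositional using (comm∧assoc⇒middleFour)
import Algebra.Properties.AbelianGroup as AbelianGroupProperties
open import Data.Nat using (ℕ)
open import Data.Fin using (Fin; zero; suc; _≟_)
open import Data.Bool using (Bool; true; false)
open import Data.Maybe using (Maybe; just; nothing)
import Data.Maybe as Maybe
open import Data.Product using (∃; _×_; _,_; proj₁)
open import Data.Sum using (_⊎_; inj₁; inj₂)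
open import Data.Unit using (⊤; tt)
open import Data.Empty using (⊥; ⊥-elim)
open import Function using (_∘_; id)
open import Function.Bundles using (_⇔_; mk⇔; Equivalence; Inverse; Injection)
open import Function.Construct.Composition using (_⇔-∘_)
open import Function.Construct.Symmetry using (⇔-sym)
open import Function.Properties.Inverse using (↔⇒↣)
open import Relation.Nullary using (¬_; yes; no)
open import Relation.Binary.PropositionalEquality

≡false⇒¬ : ∀ {b : Bool} {A : Set} → b ≡ false → (b ≡ true ⇔ A) → ¬ A
≡false⇒¬ refl b⇔A a with Equivalence.from b⇔A a
... | ()

complement-adj⇔ : ∀ {n} (G : Graph n) {x y} {A B : Set} → x ≢ y →
  (adj G x y ≡ true ⇔ A) → (adj G x y ≡ false → B) → (A → ¬ B) →
  adj (complement G) x y ≡ true ⇔ B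
complement-adj⇔ G {x} {y} x≢y adj⇔A nonadj⇒B A⇒¬B with x ≟ y
... | yes x≡y = ⊥-elim (x≢y x≡y)
... | no _ with adj G x y in e
...   | false = mk⇔ (λ _ → nonadj⇒B refl) (λ _ → refl)
...   | true  = mk⇔ (λ ()) (λ b → ⊥-elim (A⇒¬B (Equivalence.to adj⇔A refl) b))

≅-adj⇔ : ∀ {n} (G H : Graph n) {S : Fin n → Fin n → Set} (iso : G ≅ H) →
  (∀ x y → x ≢ y → adj H x y ≡ true ⇔ S x y) →
  let σ = Inverse.to (proj₁ iso) in
  ∀ x y → x ≢ y → adj G x y ≡ true ⇔ S (σ x) (σ y)
≅-adj⇔ G H (σ , adj≡) rep x y x≢y =
  rep _ _ (x≢y ∘ Injection.injective (↔⇒↣ σ)) ⇔-∘ mk⇔ (trans (sym (adj≡ x y))) (trans (adj≡ x y))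

IsMinimum-⇔ : ∀ {P Q : ℕ → Set} {k} → (∀ j → P j ⇔ Q j) → IsMinimum P k ⇔ IsMinimum Q k
IsMinimum-⇔ P⇔Q = mk⇔
  (λ (p , min) → Equivalence.to (P⇔Q _) p , λ j q → min j (Equivalence.from (P⇔Q j) q))
  (λ (q , min) → Equivalence.from (P⇔Q _) q , λ j p → min j (Equivalence.to (P⇔Q j) p))

module _ (R : RealField) where
  open RealField R

  +-abelianGroup : AbelianGroup 0ℓ 0ℓ
  +-abelianGroup = record
    { _≈_ = _≡_ ; _∙_ = _+_ ; ε = 0# ; _⁻¹ = -_
    ; isAbelianGroup = record
      { isGroup = record
        { isMonoid = record
          { isSemigroup = record
            { isMagma = record { isEquivalence = isEquivalence ; ∙-cong = cong₂ _+_ }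
            ; assoc = +-assoc
            }
          ; identity = (λ x → trans (+-comm 0# x) (+-identityʳ x)) , +-identityʳ
          }
        ; inverse = (λ x → trans (+-comm (- x) x) (+-inverseʳ x)) , +-inverseʳ
        ; ⁻¹-cong = cong -_
        }
      ; comm = +-comm
      }
    }

  open AbelianGroupProperties +-abelianGroup
    using (⁻¹-involutive; ⁻¹-∙-comm; \\-leftDividesˡ; \\-leftDividesʳ)

  infixl 6 _-_
  _-_ : Carrier → Carrier → Carrier
  a - b = a + - b

  +-monoˡ-≤ : ∀ z {a b} → a ≤ b → z + a ≤ z + b
  +-monoˡ-≤ z {a} {b} a≤b = subst₂ _≤_ (+-comm a z) (+-comm b z) (+-mono-≤ z a≤b)

  +-cancelˡ-≤ : ∀ z {a b} → z + a ≤ z + b → a ≤ b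
  +-cancelˡ-≤ z {a} {b} p = subst₂ _≤_ (\\-leftDividesʳ z a) (\\-leftDividesʳ z b) (+-monoˡ-≤ (- z) p)

  neg-antimono-≤ : ∀ {a b} → a ≤ b → - b ≤ - a
  neg-antimono-≤ {a} {b} a≤b = subst₂ _≤_ (\\-leftDividesˡ a (- b)) b+[-a-b]≡-a (+-mono-≤ (- a + - b) a≤b)
    where
    b+[-a-b]≡-a : b + (- a + - b) ≡ - a
    b+[-a-b]≡-a = trans (cong (b +_) (+-comm (- a) (- b))) (\\-leftDividesˡ b (- a))

  sub-≤⇔ : ∀ c {s m} → c - m ≤ c - s ⇔ s ≤ m
  sub-≤⇔ c {s} {m} = mk⇔
    (λ p → subst₂ _≤_ (⁻¹-involutive s) (⁻¹-involutive m) (neg-antimono-≤ (+-cancelˡ-≤ c p)))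
    (+-monoˡ-≤ c ∘ neg-antimono-≤)

  ≰⇒> : ∀ {a b} → ¬ (a ≤ b) → b < a
  ≰⇒> {a} {b} a≰b with ≤-total a b
  ... | inj₁ a≤b = ⊥-elim (a≰b a≤b)
  ... | inj₂ b≤a = b≤a , λ b≡a → a≰b (subst (a ≤_) (sym b≡a) (≤-refl a))

  <⇒≱ : ∀ {a b} → a < b → ¬ (b ≤ a)
  <⇒≱ (a≤b , a≢b) b≤a = a≢b (≤-antisym a≤b b≤a)

  <-≤-trans : ∀ {a b c} → a < b → b ≤ c → a < c
  <-≤-trans (a≤b , a≢b) b≤c =
    ≤-trans a≤b b≤c , λ a≡c → a≢b (≤-antisym a≤b (subst (_ ≤_) (sym a≡c) b≤c))

  0<2t-m : ∀ {t m} → 0# < t → m ≤ t → 0# < ((t + t) - m)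
  0<2t-m {t} {m} 0<t m≤t = <-≤-trans 0<t t≤2t-m
    where
    t≤2t-m : t ≤ (t + t) - m
    t≤2t-m = subst₂ _≤_ (+-identityʳ t) (sym (+-assoc t t (- m)))
      (+-monoˡ-≤ t (subst (_≤ t - m) (+-inverseʳ m) (+-mono-≤ (- m) m≤t)))

  reflect-+ : ∀ t a b → (t - a) + (t - b) ≡ (t + t) - (a + b)
  reflect-+ t a b = trans (comm∧assoc⇒middleFour +-comm +-assoc t (- a) t (- b))
                          (cong ((t + t) +_) (⁻¹-∙-comm a b))

  reflect-≤⇔ : ∀ t {a b m} → (t + t) - m ≤ (t - a) + (t - b) ⇔ a + b ≤ m
  reflect-≤⇔ t {a} {b} {m} = sub-≤⇔ (t + t) ⇔-∘ mk⇔ (subst ((t + t) - m ≤_) (reflect-+ t a b))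
                                                   (subst ((t + t) - m ≤_) (sym (reflect-+ t a b)))

  -- u + v ≤ m, where nothing stands for ∞ in sumLe∞ and for -∞ in sumLe-∞
  sumLe∞ : Maybe Carrier → Maybe Carrier → Carrier → Set
  sumLe∞ (just a) (just b) m = a + b ≤ m
  sumLe∞ _        _        m = ⊥

  sumLe-∞ : Maybe Carrier → Maybe Carrier → Carrier → Set
  sumLe-∞ (just a) (just b) m = a + b ≤ m
  sumLe-∞ _        _        m = ⊤

  sumLe∞-mono : ∀ u v {m m′} → m ≤ m′ → sumLe∞ u v m → sumLe∞ u v m′
  sumLe∞-mono (just a) (just b) m≤m′ p = ≤-trans p m≤m′

  sumLe-∞-mono : ∀ u v {m m′} → m ≤ m′ → sumLe-∞ u v m → sumLe-∞ u v m′
  sumLe-∞-mono nothing  v        _    _ = tt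
  sumLe-∞-mono (just a) nothing  _    _ = tt
  sumLe-∞-mono (just a) (just b) m≤m′ p = ≤-trans p m≤m′

  sumGe∞-antimono : ∀ u v {s t} → s ≤ t → sumGe∞ R u v t → sumGe∞ R u v s
  sumGe∞-antimono nothing  v        _   _ = tt
  sumGe∞-antimono (just a) nothing  _   _ = tt
  sumGe∞-antimono (just a) (just b) s≤t p = ≤-trans s≤t p

  sumGe∞-sumLe∞-< : ∀ u v {t m} → m < t → sumGe∞ R u v t → ¬ sumLe∞ u v m
  sumGe∞-sumLe∞-< (just a) (just b) m<t t≤a+b a+b≤m = <⇒≱ m<t (≤-trans t≤a+b a+b≤m)

  sumGe-∞-sumLe-∞-< : ∀ u v {t m} → m < t → sumGe-∞ R u v t → ¬ sumLe-∞ u v m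
  sumGe-∞-sumLe-∞-< (just a) (just b) m<t t≤a+b a+b≤m = <⇒≱ m<t (≤-trans t≤a+b a+b≤m)

  reflect : Carrier → Maybe Carrier → Maybe Carrier
  reflect t = Maybe.map (λ a → t - a)

  sumGe∞-reflect⇔ : ∀ t {m} u v → sumGe∞ R (reflect t u) (reflect t v) ((t + t) - m) ⇔ sumLe-∞ u v m
  sumGe∞-reflect⇔ t nothing  v        = mk⇔ id id
  sumGe∞-reflect⇔ t (just a) nothing  = mk⇔ id id
  sumGe∞-reflect⇔ t (just a) (just b) = reflect-≤⇔ t

  sumGe-∞-reflect⇔ : ∀ t {m} u v → sumGe-∞ R (reflect t u) (reflect t v) ((t + t) - m) ⇔ sumLe∞ u v m
  sumGe-∞-reflect⇔ t nothing  v        = mk⇔ id id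
  sumGe-∞-reflect⇔ t (just a) nothing  = mk⇔ id id
  sumGe-∞-reflect⇔ t (just a) (just b) = reflect-≤⇔ t

  maxPlusGe-reflect⇔ : ∀ {k} t {m} (u v : Fin k → Maybe Carrier) →
    maxPlusGe R (reflect t ∘ u) (reflect t ∘ v) ((t + t) - m) ⇔ ∃ λ i → sumLe∞ (u i) (v i) m
  maxPlusGe-reflect⇔ t u v = mk⇔
    (λ (i , p) → i , Equivalence.to (sumGe-∞-reflect⇔ t (u i) (v i)) p)
    (λ (i , p) → i , Equivalence.from (sumGe-∞-reflect⇔ t (u i) (v i)) p)

  minPlusGe-reflect⇔ : ∀ {k} t {m} (u v : Fin k → Maybe Carrier) →
    minPlusGe R (reflect t ∘ u) (reflect t ∘ v) ((t + t) - m) ⇔ ∀ i → sumLe-∞ (u i) (v i) m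
  minPlusGe-reflect⇔ t u v = mk⇔
    (λ p i → Equivalence.to (sumGe∞-reflect⇔ t (u i) (v i)) (p i))
    (λ p i → Equivalence.from (sumGe∞-reflect⇔ t (u i) (v i)) (p i))

  minPlusGe⇒¬sumLe∞ : ∀ {k t m} (u v : Fin k → Maybe Carrier) → m < t →
    minPlusGe R u v t → ¬ ∃ λ i → sumLe∞ (u i) (v i) m
  minPlusGe⇒¬sumLe∞ u v m<t ge (i , le) = sumGe∞-sumLe∞-< (u i) (v i) m<t (ge i) le

  maxPlusGe⇒¬sumLe-∞ : ∀ {k t m} (u v : Fin k → Maybe Carrier) → m < t →
    maxPlusGe R u v t → ¬ (∀ i → sumLe-∞ (u i) (v i) m)
  maxPlusGe⇒¬sumLe-∞ u v m<t (i , ge) le = sumGe-∞-sumLe-∞-< (u i) (v i) m<t ge (le i)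

  finite-<-bound : ∀ {n t} (P : Fin n → Carrier → Set) →
    (∀ i {a b} → a ≤ b → P i a → P i b) → 0# < t →
    (∀ i → ∃ λ m → m < t × P i m) → ∃ λ m → m < t × ∀ i → P i m
  finite-<-bound {ℕ.zero} P mono 0<t bound = 0# , 0<t , λ ()
  finite-<-bound {ℕ.suc n} P mono 0<t bound
    with bound zero | finite-<-bound (P ∘ suc) (λ i → mono (suc i)) 0<t (bound ∘ suc)
  ... | m₀ , m₀<t , p₀ | m , m<t , p with ≤-total m₀ m
  ...   | inj₁ m₀≤m = m  , m<t  , λ { zero → mono zero m₀≤m p₀ ; (suc i) → p i }
  ...   | inj₂ m≤m₀ = m₀ , m₀<t , λ { zero → p₀ ; (suc i) → mono (suc i) m≤m₀ (p i) }

  sumInfinite⊎finite : ∀ u v → (∀ t → sumGe∞ R u v t) ⊎ ∃ λ s → sumLe∞ u v s × sumGe∞ R u v s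
  sumInfinite⊎finite nothing  v        = inj₁ λ _ → tt
  sumInfinite⊎finite (just a) nothing  = inj₁ λ _ → tt
  sumInfinite⊎finite (just a) (just b) = inj₂ (a + b , ≤-refl _ , ≤-refl _)

  minPlusInfinite⊎attained : ∀ {k} (u v : Fin k → Maybe Carrier) →
    (∀ t → minPlusGe R u v t) ⊎ ∃ λ s → (∃ λ i → sumLe∞ (u i) (v i) s) × minPlusGe R u v s
  minPlusInfinite⊎attained {ℕ.zero} u v = inj₁ λ _ ()
  minPlusInfinite⊎attained {ℕ.suc k} u v
    with sumInfinite⊎finite (u zero) (v zero) | minPlusInfinite⊎attained (u ∘ suc) (v ∘ suc)
  ... | inj₁ h | inj₁ r = inj₁ λ t → λ { zero → h t ; (suc i) → r t i }
  ... | inj₁ h | inj₂ (s , (i , le) , ge) = inj₂ (s , (suc i , le) , λ { zero → h s ; (suc j) → ge j })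
  ... | inj₂ (a , le , ge) | inj₁ r = inj₂ (a , (zero , le) , λ { zero → ge ; (suc j) → r a j })
  ... | inj₂ (a , le₀ , ge₀) | inj₂ (s , (i , le) , ge) with ≤-total a s
  ...   | inj₁ a≤s = inj₂ (a , (zero , le₀) ,
                      λ { zero → ge₀ ; (suc j) → sumGe∞-antimono (u (suc j)) (v (suc j)) a≤s (ge j) })
  ...   | inj₂ s≤a = inj₂ (s , (suc i , le) ,
                      λ { zero → sumGe∞-antimono (u zero) (v zero) s≤a ge₀ ; (suc j) → ge j })

  -- t ≤ s is undecidable, so the low coordinate is found as the attained minimum
  ¬minPlusGe⇒sumLe∞ : ∀ {k t} (u v : Fin k → Maybe Carrier) →
    ¬ minPlusGe R u v t → ∃ λ m → m < t × ∃ λ i → sumLe∞ (u i) (v i) m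
  ¬minPlusGe⇒sumLe∞ {t = t} u v ¬ge with minPlusInfinite⊎attained u v
  ... | inj₁ infinite = ⊥-elim (¬ge (infinite t))
  ... | inj₂ (s , le , ge) =
    s , ≰⇒> (λ t≤s → ¬ge λ i → sumGe∞-antimono (u i) (v i) t≤s (ge i)) , le

  ¬maxPlusGe⇒sumLe-∞ : ∀ {k t} (u v : Fin k → Maybe Carrier) → 0# < t →
    ¬ maxPlusGe R u v t → ∃ λ m → m < t × ∀ i → sumLe-∞ (u i) (v i) m
  ¬maxPlusGe⇒sumLe-∞ {t = t} u v 0<t ¬ge =
    finite-<-bound (λ i → sumLe-∞ (u i) (v i)) (λ i → sumLe-∞-mono (u i) (v i)) 0<t
      λ i → below (u i) (v i) (λ ge → ¬ge (i , ge))
    where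
    below : ∀ a b → ¬ sumGe-∞ R a b t → ∃ λ m → m < t × sumLe-∞ a b m
    below nothing  b        _   = 0# , 0<t , tt
    below (just a) nothing  _   = 0# , 0<t , tt
    below (just a) (just b) ¬ge = a + b , ≰⇒> ¬ge , ≤-refl _

  nonEdge-<-bound : ∀ {n t} (G : Graph n) (Q : Fin n → Fin n → Carrier → Set) →
    (∀ x y {a b} → a ≤ b → Q x y a → Q x y b) → 0# < t →
    (∀ x y → x ≢ y → adj G x y ≡ false → ∃ λ m → m < t × Q x y m) →
    ∃ λ m → m < t × ∀ x y → x ≢ y → adj G x y ≡ false → Q x y m
  nonEdge-<-bound {t = t} G Q mono 0<t bound =
    finite-<-bound _ (λ x a≤b q y x≢y e → mono x y a≤b (q y x≢y e)) 0<t λ x →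
      finite-<-bound _ (λ y a≤b q x≢y e → mono x y a≤b (q x≢y e)) 0<t λ y → pair x y
    where
    pair : ∀ x y → ∃ λ m → m < t × (x ≢ y → adj G x y ≡ false → Q x y m)
    pair x y with adj G x y in e | x ≟ y
    ... | true  | _        = 0# , 0<t , λ _ ()
    ... | false | yes x≡y  = 0# , 0<t , λ x≢y _ → ⊥-elim (x≢y x≡y)
    ... | false | no x≢y   = let m , m<t , q = bound x y x≢y e in m , m<t , λ _ _ → q

  TropRep⇒TropRepMax-complement : ∀ {n k} (G : Graph n) → TropRep R G k → TropRepMax R (complement G) k
  TropRep⇒TropRepMax-complement G (f , t , 0<t , rep)
    with nonEdge-<-bound G (λ x y m → ∃ λ i → sumLe∞ (f x i) (f y i) m)
           (λ x y a≤b (i , le) → i , sumLe∞-mono (f x i) (f y i) a≤b le) 0<t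
           (λ x y x≢y e → ¬minPlusGe⇒sumLe∞ (f x) (f y) (≡false⇒¬ e (rep x y x≢y)))
  ... | m , m<t , margin =
    (λ x → reflect t ∘ f x) , (t + t) - m , 0<2t-m 0<t (proj₁ m<t) , λ x y x≢y →
    ⇔-sym (maxPlusGe-reflect⇔ t (f x) (f y)) ⇔-∘
    complement-adj⇔ G x≢y (rep x y x≢y) (margin x y x≢y) (minPlusGe⇒¬sumLe∞ (f x) (f y) m<t)

  TropRepMax⇒TropRep-complement : ∀ {n k} (G : Graph n) → TropRepMax R G k → TropRep R (complement G) k
  TropRepMax⇒TropRep-complement G (f , t , 0<t , rep)
    with nonEdge-<-bound G (λ x y m → ∀ i → sumLe-∞ (f x i) (f y i) m)
           (λ x y a≤b le i → sumLe-∞-mono (f x i) (f y i) a≤b (le i)) 0<t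
           (λ x y x≢y e → ¬maxPlusGe⇒sumLe-∞ (f x) (f y) 0<t (≡false⇒¬ e (rep x y x≢y)))
  ... | m , m<t , margin =
    (λ x → reflect t ∘ f x) , (t + t) - m , 0<2t-m 0<t (proj₁ m<t) , λ x y x≢y →
    ⇔-sym (minPlusGe-reflect⇔ t (f x) (f y)) ⇔-∘
    complement-adj⇔ G x≢y (rep x y x≢y) (margin x y x≢y) (maxPlusGe⇒¬sumLe-∞ (f x) (f y) m<t)

  TropRep-≅ : ∀ {n k} (G H : Graph n) → G ≅ H → TropRep R H k → TropRep R G k
  TropRep-≅ G H iso (f , t , 0<t , rep) =
    (λ x → f (Inverse.to (proj₁ iso) x)) , t , 0<t ,
    ≅-adj⇔ G H {S = λ x y → minPlusGe R (f x) (f y) t} iso rep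

  TropRepMax-≅ : ∀ {n k} (G H : Graph n) → G ≅ H → TropRepMax R H k → TropRepMax R G k
  TropRepMax-≅ G H iso (f , t , 0<t , rep) =
    (λ x → f (Inverse.to (proj₁ iso) x)) , t , 0<t ,
    ≅-adj⇔ G H {S = λ x y → maxPlusGe R (f x) (f y) t} iso rep

mainTheorem9 : (R : RealField) (n : ℕ) (G : Graph n) → SelfComplementary G →
    (k : ℕ) → IsRhoT R G k ⇔ IsRhoTMax R G k
mainTheorem9 R n G G≅Ḡ k = IsMinimum-⇔ λ j → mk⇔
  (λ rep → TropRepMax-≅ R G (complement G) G≅Ḡ (TropRep⇒TropRepMax-complement R G rep))
  (λ rep → TropRep-≅ R G (complement G) G≅Ḡ (TropRepMax⇒TropRep-complement R G rep))
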